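{- Let $(u_n)_{n\geq 1}$ be a sequence of positive integers and let $(a_n)_{n\geq 1}$ be the sequence of positive integers defined by $a_n=\prod_{d\mid n}u_d$ for all $n\geq 1$. Then for all $n,k\in\mathbb{N}$ with $n\geq k$, \[\binom{n}{k}_{\mathbf{a}}=\prod_{d}u_d,\] where the product is taken over all positive integers $d\leq n$ such that $\left\lfloor \frac{k}{d}\right\rfloor+\left\lfloor\frac{n-k}{d}\right\rfloor<\left\lfloor\frac{n}{d}\right\rfloor$. In particular, all the $\mathbf{a}$-binomial coefficients $\binom{n}{k}_{\mathbf{a}}$ ($n,k\in\mathbb{N}$, $n\geq k$) are positive integers.
   Context: For a sequence of positive integers $\mathbf{a}=(a_n)_{n\geq 1}$ and $n\in\mathbb{N}$, let $[n]_{\mathbf{a}}!:=a_1a_2\cdots a_n$ (with $[0]_{\mathbf{a}}!=1$). For $n,k\in\mathbb{N}$ with $n\geq k$, the $\mathbf{a}$-binomial coefficient is the positive rational number $\binom{n}{k}_{\mathbf{a}}:=\frac{a_na_{n-1}\cdots a_{n-k+1}}{a_1a_2\cdots a_k}=\frac{[n]_{\mathbf{a}}!}{[k]_{\mathbf{a}}![n-k]_{\mathbf{a}}!}$. $\lfloor\cdot\rfloor$ is the integer-part (floor) function. -}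

module Defs where

open import Data.Nat using (ℕ; zero; suc; _+_; _*_; _∸_; _≤_; _<_; z≤n; s≤s; NonZero; >-nonZero)
open import Data.Nat.Properties using (*-mono-<)
open import Data.Nat.Divisibility using (_∣?_)
open import Data.List using (List; []; _∷_; _++_; filter; map)
open import Data.Nat.ListAction using (product)
open import Data.List.Relation.Unary.All using (All; []; _∷_)
open import Data.List.Relation.Unary.All.Properties using (++⁺; filter⁺)
import Data.Rational as ℚ
open import Data.Integer using (+_)

range1 : ℕ → List ℕ
range1 zero = []
range1 (suc n) = range1 n ++ (suc n ∷ [])

divProd : (ℕ → ℕ) → ℕ → ℕ
divProd u n = product (map u (filter (λ d → d ∣? n) (range1 n)))

fact : (ℕ → ℕ) → ℕ → ℕ
fact a n = product (map a (range1 n))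

-- (a_n)_{n ≥ 1} consists of positive integers (the value at index 0 is irrelevant)
Positive : (ℕ → ℕ) → Set
Positive a = ∀ n → 1 ≤ n → 0 < a n

private
  range1-ge1 : ∀ n → All (1 ≤_) (range1 n)
  range1-ge1 zero = []
  range1-ge1 (suc n) = ++⁺ (range1-ge1 n) (s≤s z≤n ∷ [])

  prod-pos : (a : ℕ → ℕ) → Positive a → (xs : List ℕ) → All (1 ≤_) xs → 0 < product (map a xs)
  prod-pos a pos [] [] = s≤s z≤n
  prod-pos a pos (x ∷ xs) (p ∷ ps) = *-mono-< (pos x p) (prod-pos a pos xs ps)

divProd-pos : (u : ℕ → ℕ) → Positive u → Positive (divProd u)
divProd-pos u pos n _ = prod-pos u pos _ (filter⁺ (λ d → d ∣? n) (range1-ge1 n))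

fact-pos : (a : ℕ → ℕ) → Positive a → ∀ n → 0 < fact a n
fact-pos a pos n = prod-pos a pos (range1 n) (range1-ge1 n)

binomA : (a : ℕ → ℕ) → Positive a → (n k : ℕ) → ℚ.ℚ
binomA a pos n k =
  ℚ._/_ (+ fact a n) (fact a k * fact a (n ∸ k))
    {{>-nonZero (*-mono-< (fact-pos a pos k) (fact-pos a pos (n ∸ k)))}}

-- ∏ u_d over 1 ≤ d ≤ n with ⌊k/d⌋ + ⌊(n-k)/d⌋ < ⌊n/d⌋
-- (d is NonZero since it comes from range1 n; we use a total division helper)
open import Data.Nat using (_<?_; _/_)

floorDiv : ℕ → ℕ → ℕ
floorDiv m zero = 0
floorDiv m (suc d) = m / suc d

carryProd : (ℕ → ℕ) → ℕ → ℕ → ℕ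
carryProd u n k =
  product (map u (filter (λ d → (floorDiv k d + floorDiv (n ∸ k) d) <? floorDiv n d) (range1 n)))

-- In a_1 ⋯ a_m the factor u_d occurs once for each multiple of d up to m, so
-- [m]_a! = ∏_{d ≤ m} u_d ^ ⌊m/d⌋. Moreover ⌊n/d⌋ − ⌊k/d⌋ − ⌊(n−k)/d⌋ is 1 when
-- (k mod d) + ((n−k) mod d) ≥ d and 0 otherwise, so [n]_a! / ([k]_a! [n−k]_a!) is the
-- product of the u_d for which this difference is positive.
module Submission where

open import Defs
open import Data.Nat using (ℕ; _≤_; _∸_)
open import Data.Integer using (+_)
open import Data.Rational using (ℚ; _/_)
open import Relation.Binary.PropositionalEquality using (_≡_)

open import Data.Bool.Base using (Bool; true; false)
open import Data.Nat.Base
  using (zero; suc; _+_; _*_; _^_; _<_; _%_; z≤n; s≤s; NonZero; >-nonZero)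
  renaming (_/_ to _div_)
open import Data.Nat.Properties
open import Data.Nat using (_<?_)
open import Data.Nat.DivMod
  using (m≡m%n+[m/n]*n; m%n<n; m/n*n≤m; m*n/n≡m; /-monoˡ-≤; m<n*o⇒m/o<n;
         m/n*n≡m; +-distrib-/-∣ˡ; n/n≡1; m<n⇒m/n≡0)
open import Data.Nat.Divisibility using (_∣_; _∣?_; divides; ∣-refl)
open import Data.List.Base using ([]; _∷_; _++_; filter; map)
open import Data.List.Properties using (map-++)
open import Data.Nat.ListAction using (product)
open import Data.Nat.ListAction.Properties using (product-++)
open import Data.Nat.Solver using (module +-*-Solver)
open import Data.Sum.Base using (inj₁; inj₂)
open import Function.Bundles using (_⇔_; mk⇔)
open import Relation.Nullary using (Dec; does)
open import Relation.Nullary.Decidable using (dec-true; dec-false; does-⇔)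
open import Relation.Binary.PropositionalEquality
  using (refl; sym; trans; cong; cong₂; subst; module ≡-Reasoning)
import Data.Integer.Properties as ℤ
import Data.Rational.Properties as ℚ
import Data.Rational.Unnormalised as ℚᵘ

indicator : Bool → ℕ
indicator true  = 1
indicator false = 0

indicator-< : ∀ {a b} → a ≤ b → b ≤ suc a → indicator (does (a <? b)) + a ≡ b
indicator-< {a} {b} a≤b b≤1+a with m≤n⇒m<n∨m≡n a≤b
... | inj₂ refl = cong (λ t → indicator t + a) (dec-false (a <? a) (<-irrefl refl))
... | inj₁ a<b  = trans (cong (λ t → indicator t + a) (dec-true (a <? b) a<b))
                        (≤-antisym a<b b≤1+a)

*≤⇒≤/ : ∀ {a m} d .{{_ : NonZero d}} → a * d ≤ m → a ≤ m div d
*≤⇒≤/ {a} d a*d≤m = subst (_≤ _) (m*n/n≡m a d) (/-monoˡ-≤ d a*d≤m)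

m<[1+m/n]*n : ∀ m n .{{_ : NonZero n}} → m < suc (m div n) * n
m<[1+m/n]*n m n = begin-strict
  m                         ≡⟨ m≡m%n+[m/n]*n m n ⟩
  m % n + m div n * n       <⟨ +-monoˡ-< (m div n * n) (m%n<n m n) ⟩
  n + m div n * n           ≡⟨⟩
  suc (m div n) * n         ∎
  where open ≤-Reasoning

/-+-lower : ∀ m n d .{{_ : NonZero d}} → m div d + n div d ≤ (m + n) div d
/-+-lower m n d = *≤⇒≤/ d (begin
  (m div d + n div d) * d     ≡⟨ *-distribʳ-+ d (m div d) (n div d) ⟩
  m div d * d + n div d * d   ≤⟨ +-mono-≤ (m/n*n≤m m d) (m/n*n≤m n d) ⟩
  m + n                       ∎)
  where open ≤-Reasoning

/-+-upper : ∀ m n d .{{_ : NonZero d}} → (m + n) div d ≤ suc (m div d + n div d)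
/-+-upper m n d = <⇒≤pred (m<n*o⇒m/o<n (begin-strict
  m + n                                 <⟨ +-mono-< (m<[1+m/n]*n m d) (m<[1+m/n]*n n d) ⟩
  suc (m div d) * d + suc (n div d) * d ≡⟨ *-distribʳ-+ d (suc (m div d)) (suc (n div d)) ⟨
  (suc (m div d) + suc (n div d)) * d   ≡⟨ cong (_* d) (cong suc (+-suc (m div d) (n div d))) ⟩
  suc (suc (m div d + n div d)) * d     ∎))
  where open ≤-Reasoning

/-suc-upper : ∀ m d .{{_ : NonZero d}} → suc m div d ≤ suc (m div d)
/-suc-upper m d@(suc _) = begin
  suc m div d        ≤⟨ /-monoˡ-≤ d (+-monoˡ-≤ m (s≤s z≤n)) ⟩
  (d + m) div d      ≡⟨ +-distrib-/-∣ˡ m ∣-refl ⟩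
  d div d + m div d  ≡⟨ cong (_+ m div d) (n/n≡1 d) ⟩
  suc (m div d)      ∎
  where open ≤-Reasoning

/-suc-jump⇔∣ : ∀ m d .{{_ : NonZero d}} → m div d < suc m div d ⇔ d ∣ suc m
/-suc-jump⇔∣ m d = mk⇔ jump⇒∣ ∣⇒jump
  where
  open ≤-Reasoning
  jump⇒∣ : m div d < suc m div d → d ∣ suc m
  jump⇒∣ jump = divides (suc m div d) (≤-antisym (begin
    suc m             ≤⟨ m<[1+m/n]*n m d ⟩
    suc (m div d) * d ≤⟨ *-monoˡ-≤ d jump ⟩
    suc m div d * d   ∎) (m/n*n≤m (suc m) d))
  ∣⇒jump : d ∣ suc m → m div d < suc m div d
  ∣⇒jump d∣1+m = *-cancelʳ-< _ (m div d) (suc m div d) (begin-strict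
    m div d * d       ≤⟨ m/n*n≤m m d ⟩
    m                 <⟨ n<1+n m ⟩
    suc m             ≡⟨ m/n*n≡m d∣1+m ⟨
    suc m div d * d   ∎)

/-suc : ∀ m d .{{_ : NonZero d}} → indicator (does (d ∣? suc m)) + m div d ≡ suc m div d
/-suc m d = begin
  indicator (does (d ∣? suc m)) + m div d               ≡⟨ cong (λ t → indicator t + m div d) jump≡∣ ⟨
  indicator (does (m div d <? suc m div d)) + m div d   ≡⟨ indicator-< (/-monoˡ-≤ d (n≤1+n m)) (/-suc-upper m d) ⟩
  suc m div d                                           ∎
  where
  open ≡-Reasoning
  jump≡∣ : does (m div d <? suc m div d) ≡ does (d ∣? suc m)
  jump≡∣ = does-⇔ (/-suc-jump⇔∣ m d) (m div d <? suc m div d) (d ∣? suc m)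

/-+-carry : ∀ m n d .{{_ : NonZero d}} →
  indicator (does (m div d + n div d <? (m + n) div d)) + (m div d + n div d) ≡ (m + n) div d
/-+-carry m n d = indicator-< (/-+-lower m n d) (/-+-upper m n d)

floorDiv-< : ∀ {m d} → m < d → floorDiv m d ≡ 0
floorDiv-< {d = suc _} m<d = m<n⇒m/n≡0 m<d

productUpTo : (ℕ → ℕ) → ℕ → ℕ
productUpTo g zero    = 1
productUpTo g (suc N) = productUpTo g N * g (suc N)

product-map-range1 : ∀ g N → product (map g (range1 N)) ≡ productUpTo g N
product-map-range1 g zero    = refl
product-map-range1 g (suc N) = begin
  product (map g (range1 N ++ suc N ∷ []))        ≡⟨ cong product (map-++ g (range1 N) (suc N ∷ [])) ⟩
  product (map g (range1 N) ++ g (suc N) ∷ [])    ≡⟨ product-++ (map g (range1 N)) (g (suc N) ∷ []) ⟩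
  product (map g (range1 N)) * (g (suc N) * 1)    ≡⟨ cong₂ _*_ (product-map-range1 g N) (*-identityʳ _) ⟩
  productUpTo g N * g (suc N)                     ∎
  where open ≡-Reasoning

productUpTo-cong : ∀ {f g} → (∀ d → f (suc d) ≡ g (suc d)) → ∀ N → productUpTo f N ≡ productUpTo g N
productUpTo-cong f≗g zero    = refl
productUpTo-cong f≗g (suc N) = cong₂ _*_ (productUpTo-cong f≗g N) (f≗g N)

productUpTo-* : ∀ f g N → productUpTo f N * productUpTo g N ≡ productUpTo (λ d → f d * g d) N
productUpTo-* f g zero    = refl
productUpTo-* f g (suc N) = begin
  (productUpTo f N * f (suc N)) * (productUpTo g N * g (suc N))
    ≡⟨ interchange (productUpTo f N) (f (suc N)) (productUpTo g N) (g (suc N)) ⟩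
  (productUpTo f N * productUpTo g N) * (f (suc N) * g (suc N))
    ≡⟨ cong (_* (f (suc N) * g (suc N))) (productUpTo-* f g N) ⟩
  productUpTo (λ d → f d * g d) N * (f (suc N) * g (suc N)) ∎
  where
  open ≡-Reasoning
  open +-*-Solver
  interchange : ∀ a b c e → (a * b) * (c * e) ≡ (a * c) * (b * e)
  interchange = solve 4 (λ a b c e → (a :* b) :* (c :* e) := (a :* c) :* (b :* e)) refl

productUpTo-extend : ∀ {g M N} → M ≤ N → (∀ d → M < d → g d ≡ 1) → productUpTo g N ≡ productUpTo g M
productUpTo-extend {N = zero}  z≤n _ = refl
productUpTo-extend {N = suc N} M≤1+N g≡1 with m≤n⇒m<n∨m≡n M≤1+N
... | inj₂ refl       = refl
... | inj₁ (s≤s M≤N) = trans (cong₂ _*_ (productUpTo-extend M≤N g≡1) (g≡1 (suc N) (s≤s M≤N)))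
                             (*-identityʳ _)

prodPow : (ℕ → ℕ) → (ℕ → ℕ) → ℕ → ℕ
prodPow u e = productUpTo (λ d → u d ^ e d)

prodPow-+ : ∀ u e f N → prodPow u e N * prodPow u f N ≡ prodPow u (λ d → e d + f d) N
prodPow-+ u e f N = trans (productUpTo-* _ _ N)
  (productUpTo-cong (λ d → sym (^-distribˡ-+-* (u (suc d)) (e (suc d)) (f (suc d)))) N)

prodPow-cong : ∀ u e f → (∀ d → e (suc d) ≡ f (suc d)) → ∀ N → prodPow u e N ≡ prodPow u f N
prodPow-cong u e f e≗f = productUpTo-cong (λ d → cong (u (suc d) ^_) (e≗f d))

prodPow-extend : ∀ u {e M N} → M ≤ N → (∀ d → M < d → e d ≡ 0) → prodPow u e N ≡ prodPow u e M
prodPow-extend u M≤N e≡0 = productUpTo-extend M≤N (λ d M<d → cong (u d ^_) (e≡0 d M<d))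

product-map-filter : ∀ u {P : ℕ → Set} (P? : ∀ d → Dec (P d)) xs →
  product (map u (filter P? xs)) ≡ product (map (λ d → u d ^ indicator (does (P? d))) xs)
product-map-filter u P? []       = refl
product-map-filter u P? (x ∷ xs) with does (P? x)
... | true  = cong₂ _*_ (sym (*-identityʳ (u x))) (product-map-filter u P? xs)
... | false = trans (product-map-filter u P? xs) (sym (+-identityʳ _))

product-map-filter-range1 : ∀ u {P : ℕ → Set} (P? : ∀ d → Dec (P d)) N →
  product (map u (filter P? (range1 N))) ≡ prodPow u (λ d → indicator (does (P? d))) N
product-map-filter-range1 u P? N =
  trans (product-map-filter u P? (range1 N)) (product-map-range1 _ N)

prodPow-floorDiv : ∀ u {m N} → m ≤ N → prodPow u (floorDiv m) m ≡ prodPow u (floorDiv m) N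
prodPow-floorDiv u m≤N = sym (prodPow-extend u m≤N (λ _ → floorDiv-<))

fact-divProd : ∀ u m → fact (divProd u) m ≡ prodPow u (floorDiv m) m
fact-divProd u zero    = refl
fact-divProd u (suc m) = begin
  fact (divProd u) (suc m)
    ≡⟨ product-map-range1 (divProd u) (suc m) ⟩
  productUpTo (divProd u) m * divProd u (suc m)
    ≡⟨ cong₂ _*_ (sym (product-map-range1 (divProd u) m))
                 (product-map-filter-range1 u (_∣? suc m) (suc m)) ⟩
  fact (divProd u) m * prodPow u divides-1+m (suc m)
    ≡⟨ cong (_* prodPow u divides-1+m (suc m))
            (trans (fact-divProd u m) (prodPow-floorDiv u (n≤1+n m))) ⟩
  prodPow u (floorDiv m) (suc m) * prodPow u divides-1+m (suc m)
    ≡⟨ prodPow-+ u (floorDiv m) divides-1+m (suc m) ⟩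
  prodPow u (λ d → floorDiv m d + divides-1+m d) (suc m)
    ≡⟨ prodPow-cong u (λ d → floorDiv m d + divides-1+m d) (floorDiv (suc m)) exponent (suc m) ⟩
  prodPow u (floorDiv (suc m)) (suc m) ∎
  where
  open ≡-Reasoning
  divides-1+m : ℕ → ℕ
  divides-1+m d = indicator (does (d ∣? suc m))
  exponent : ∀ d → floorDiv m (suc d) + divides-1+m (suc d) ≡ floorDiv (suc m) (suc d)
  exponent d = trans (+-comm (m div suc d) _) (/-suc m (suc d))

fact-divProd-binomial : ∀ u {n k} → k ≤ n →
  fact (divProd u) n ≡ carryProd u n k * (fact (divProd u) k * fact (divProd u) (n ∸ k))
fact-divProd-binomial u {n} {k} k≤n = sym (begin
  carryProd u n k * (fact a k * fact a (n ∸ k))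
    ≡⟨ cong₂ _*_ (product-map-filter-range1 u (λ d → floorSum d <? floorDiv n d) n)
                 (cong₂ _*_ (trans (fact-divProd u k) (prodPow-floorDiv u k≤n))
                            (trans (fact-divProd u (n ∸ k)) (prodPow-floorDiv u (m∸n≤m n k)))) ⟩
  prodPow u carry n * (prodPow u (floorDiv k) n * prodPow u (floorDiv (n ∸ k)) n)
    ≡⟨ cong (prodPow u carry n *_) (prodPow-+ u (floorDiv k) (floorDiv (n ∸ k)) n) ⟩
  prodPow u carry n * prodPow u floorSum n
    ≡⟨ prodPow-+ u carry floorSum n ⟩
  prodPow u (λ d → carry d + floorSum d) n
    ≡⟨ prodPow-cong u (λ d → carry d + floorSum d) (floorDiv n) exponent n ⟩
  prodPow u (floorDiv n) n
    ≡⟨ fact-divProd u n ⟨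
  fact a n ∎)
  where
  open ≡-Reasoning
  a : ℕ → ℕ
  a = divProd u
  floorSum : ℕ → ℕ
  floorSum d = floorDiv k d + floorDiv (n ∸ k) d
  carry : ℕ → ℕ
  carry d = indicator (does (floorSum d <? floorDiv n d))
  exponent : ∀ d → carry (suc d) + floorSum (suc d) ≡ floorDiv n (suc d)
  exponent d = subst (λ x → indicator (does (floorSum (suc d) <? x div suc d)) + floorSum (suc d)
                               ≡ x div suc d)
                     (m+[n∸m]≡n k≤n) (/-+-carry k (n ∸ k) (suc d))

m≡o*n⇒+m/n≡+o/1 : ∀ {m} o n .{{_ : NonZero n}} → m ≡ o * n → + m / n ≡ + o / 1
m≡o*n⇒+m/n≡+o/1 o (suc n) refl =
  ℚ.fromℚᵘ-cong {ℚᵘ.mkℚᵘ (+ (o * suc n)) n} {ℚᵘ.mkℚᵘ (+ o) 0}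
    (ℚᵘ.*≡* (trans (ℤ.*-identityʳ _) (ℤ.pos-* o (suc n))))

mainTheorem1 : (u : ℕ → ℕ) → (upos : Positive u) →
    (n k : ℕ) → k ≤ n →
    binomA (divProd u) (divProd-pos u upos) n k ≡ (+ carryProd u n k) / 1
mainTheorem1 u upos n k k≤n =
  m≡o*n⇒+m/n≡+o/1 (carryProd u n k) (fact (divProd u) k * fact (divProd u) (n ∸ k))
    {{denominator≢0}} (fact-divProd-binomial u k≤n)
  where
  denominator≢0 : NonZero (fact (divProd u) k * fact (divProd u) (n ∸ k))
  denominator≢0 = >-nonZero (*-mono-< (fact-pos _ (divProd-pos u upos) k)
                                (fact-pos _ (divProd-pos u upos) (n ∸ k)))
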